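{- For each natural number $k>0$, $\mathsf{HA}+\mathrm{DNS}(\mathrm{U}_k^+)\vdash\neg\neg\mathrm{LEM}(\Sigma_{k-1})$.
   Context: $\mathsf{HA}$ is intuitionistic (Heyting) arithmetic in the language with function symbols for all primitive recursive functions and logical constants $\forall,\exists,\to,\land,\lor,\perp$; $\neg\varphi$ abbreviates $\varphi\to\perp$. $S+\mathrm{P}$ adds all instances of schema $\mathrm{P}$ to $S$; $S\vdash\mathrm{P}$ means all instances of $\mathrm{P}$ are provable. $\Sigma_0=\Pi_0$ are the quantifier-free formulas; $\Pi_{k+1}$: formulas $Q_1\bar x_1\cdots Q_{k+1}\bar x_{k+1}\varphi_{qf}$ ($Q_i=\forall$ for odd $i$, $\exists$ for even $i$); $\Sigma_{k+1}$ likewise starting with $\exists$. $\Gamma(x,y)$: formulas in $\Gamma$ with free variables among $x,y$. $\mathrm{LEM}(\Gamma)$: $\forall x(\varphi(x)\lor\neg\varphi(x))$, $\varphi(x)\in\Gamma(x)$; $\neg\neg\mathrm{LEM}(\Gamma)$: $\neg\neg\xi$ for $\xi$ an instance (a sentence) of $\mathrm{LEM}(\Gamma)$. $\mathrm{DNS}(\Gamma)$: $\forall x(\forall y\neg\neg\varphi(x,y)\to\neg\neg\forall y\varphi(x,y))$, $\varphi(x,y)\in\Gamma(x,y)$. Alternation paths: finite alternating sequences of $+,-$; $i(s)$ first symbol ($\times$ if empty), $s^\perp$ swaps signs, $l(s)$ length. $\mathrm{Alt}(\varphi)=\{\langle\rangle\}$ for quantifier-free $\varphi$; otherwise $\mathrm{Alt}(\neg\varphi_1)=\{s^\perp:s\in\mathrm{Alt}(\varphi_1)\}$,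 $\mathrm{Alt}(\varphi_1\land\varphi_2)=\mathrm{Alt}(\varphi_1\lor\varphi_2)=\mathrm{Alt}(\varphi_1)\cup\mathrm{Alt}(\varphi_2)$, $\mathrm{Alt}(\varphi_1\to\varphi_2)=\{s^\perp:s\in\mathrm{Alt}(\varphi_1)\}\cup\mathrm{Alt}(\varphi_2)$, $\mathrm{Alt}(\forall x\varphi_1)=\{s\in\mathrm{Alt}(\varphi_1):i(s)=-\}\cup\{ -s:s\in\mathrm{Alt}(\varphi_1),i(s)\ne-\}$, $\mathrm{Alt}(\exists x\varphi_1)=\{s\in\mathrm{Alt}(\varphi_1):i(s)=+\}\cup\{+s:s\in\mathrm{Alt}(\varphi_1),i(s)\ne+\}$. $\deg\varphi=\max\{l(s):s\in\mathrm{Alt}(\varphi)\}$, $\mathrm{F}_k=\{\varphi:\deg\varphi=k\}$, $\mathrm{U}_0=\mathrm{F}_0$, $\mathrm{U}_{k+1}=\{\varphi\in\mathrm{F}_{k+1}:i(s)=-$ for all $s\in\mathrm{Alt}(\varphi)$ with $l(s)=k+1\}$, $\mathrm{U}_k^+=\mathrm{U}_k\cup\bigcup_{i<k}\mathrm{F}_i$. -}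

module Defs where

open import Data.Nat using (ℕ; zero; suc; _<_; _⊔_)
open import Data.Fin using (Fin; toℕ)
open import Data.Vec using (Vec; []; _∷_; lookup; tabulate)
import Data.Vec as Vec
open import Data.List using (List; []; _∷_; _++_; map; foldr; length)
open import Data.List.Membership.Propositional using (_∈_)
open import Data.List.Relation.Unary.All using (All)
open import Data.Maybe using (Maybe; just; nothing)
open import Data.Product using (_×_)
open import Data.Sum using (_⊎_)
open import Data.Unit using (⊤)
open import Data.Empty using (⊥)
open import Relation.Binary.PropositionalEquality using (_≡_)
open import Relation.Nullary using (¬_)

-- Variables are de Bruijn indices.

data PR : ℕ → Set where
  zeroF : PR 0
  succF : PR 1
  proj  : ∀ {n} → Fin n → PR n
  comp  : ∀ {n m} → PR m → Vec (PR n) m → PR n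
  -- rec g h (0 , x⃗) = g x⃗ ;  rec g h (S y , x⃗) = h (y , rec g h (y , x⃗) , x⃗)
  rec   : ∀ {n} → PR n → PR (suc (suc n)) → PR (suc n)

data Term : Set where
  var : ℕ → Term
  app : ∀ {n} → PR n → Vec Term n → Term

infix  7 _≐_
infixr 6 _∧'_
infixr 5 _∨'_
infixr 4 _⇒_

data Formula : Set where
  _≐_  : Term → Term → Formula
  ⊥'   : Formula
  _∧'_ : Formula → Formula → Formula
  _∨'_ : Formula → Formula → Formula
  _⇒_  : Formula → Formula → Formula
  ∀'   : Formula → Formula
  ∃'   : Formula → Formula

¬' : Formula → Formula
¬' φ = φ ⇒ ⊥'

∀^ : ℕ → Formula → Formula
∀^ zero    φ = φ
∀^ (suc n) φ = ∀' (∀^ n φ)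

Subst : Set
Subst = ℕ → Term

mutual
  substT : Subst → Term → Term
  substT σ (var i)    = σ i
  substT σ (app f ts) = app f (substV σ ts)

  substV : ∀ {n} → Subst → Vec Term n → Vec Term n
  substV σ []       = []
  substV σ (t ∷ ts) = substT σ t ∷ substV σ ts

shiftT : Term → Term
shiftT = substT (λ i → var (suc i))

lift : Subst → Subst
lift σ zero    = var zero
lift σ (suc i) = shiftT (σ i)

substF : Subst → Formula → Formula
substF σ (s ≐ t)  = substT σ s ≐ substT σ t
substF σ ⊥'       = ⊥'
substF σ (φ ∧' ψ) = substF σ φ ∧' substF σ ψ
substF σ (φ ∨' ψ) = substF σ φ ∨' substF σ ψ
substF σ (φ ⇒ ψ)  = substF σ φ ⇒ substF σ ψ
substF σ (∀' φ)   = ∀' (substF (lift σ) φ)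
substF σ (∃' φ)   = ∃' (substF (lift σ) φ)

shiftF : Formula → Formula
shiftF = substF (λ i → var (suc i))

sub0 : Term → Subst
sub0 t zero    = t
sub0 t (suc i) = var i

_[_/0] : Formula → Term → Formula
φ [ t /0] = substF (sub0 t) φ

mutual
  WfT : ℕ → Term → Set
  WfT n (var i)    = i < n
  WfT n (app f ts) = WfV n ts

  WfV : ∀ {m} → ℕ → Vec Term m → Set
  WfV n []       = ⊤
  WfV n (t ∷ ts) = WfT n t × WfV n ts

Wf : ℕ → Formula → Set
Wf n (s ≐ t)  = WfT n s × WfT n t
Wf n ⊥'       = ⊤
Wf n (φ ∧' ψ) = Wf n φ × Wf n ψ
Wf n (φ ∨' ψ) = Wf n φ × Wf n ψ
Wf n (φ ⇒ ψ)  = Wf n φ × Wf n ψ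
Wf n (∀' φ)   = Wf (suc n) φ
Wf n (∃' φ)   = Wf (suc n) φ

-- Axioms may contain free variables; every substitution instance of an
-- axiom may be used (equivalent to taking universal closures).

infix 2 _∣_⊢_

data _∣_⊢_ (T : Formula → Set) : List Formula → Formula → Set where
  hyp  : ∀ {Γ φ} → φ ∈ Γ → T ∣ Γ ⊢ φ
  ax   : ∀ {Γ φ} → T φ → (σ : Subst) → T ∣ Γ ⊢ substF σ φ
  ⊥E   : ∀ {Γ φ} → T ∣ Γ ⊢ ⊥' → T ∣ Γ ⊢ φ
  ∧I   : ∀ {Γ φ ψ} → T ∣ Γ ⊢ φ → T ∣ Γ ⊢ ψ → T ∣ Γ ⊢ φ ∧' ψ
  ∧E₁  : ∀ {Γ φ ψ} → T ∣ Γ ⊢ φ ∧' ψ → T ∣ Γ ⊢ φ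
  ∧E₂  : ∀ {Γ φ ψ} → T ∣ Γ ⊢ φ ∧' ψ → T ∣ Γ ⊢ ψ
  ∨I₁  : ∀ {Γ φ ψ} → T ∣ Γ ⊢ φ → T ∣ Γ ⊢ φ ∨' ψ
  ∨I₂  : ∀ {Γ φ ψ} → T ∣ Γ ⊢ ψ → T ∣ Γ ⊢ φ ∨' ψ
  ∨E   : ∀ {Γ φ ψ χ} → T ∣ Γ ⊢ φ ∨' ψ → T ∣ φ ∷ Γ ⊢ χ → T ∣ ψ ∷ Γ ⊢ χ → T ∣ Γ ⊢ χ
  ⇒I   : ∀ {Γ φ ψ} → T ∣ φ ∷ Γ ⊢ ψ → T ∣ Γ ⊢ φ ⇒ ψ
  ⇒E   : ∀ {Γ φ ψ} → T ∣ Γ ⊢ φ ⇒ ψ → T ∣ Γ ⊢ φ → T ∣ Γ ⊢ ψ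
  ∀I   : ∀ {Γ φ} → T ∣ map shiftF Γ ⊢ φ → T ∣ Γ ⊢ ∀' φ
  ∀E   : ∀ {Γ φ} → T ∣ Γ ⊢ ∀' φ → (t : Term) → T ∣ Γ ⊢ φ [ t /0]
  ∃I   : ∀ {Γ φ} (t : Term) → T ∣ Γ ⊢ φ [ t /0] → T ∣ Γ ⊢ ∃' φ
  ∃E   : ∀ {Γ φ ψ} → T ∣ Γ ⊢ ∃' φ → T ∣ φ ∷ map shiftF Γ ⊢ shiftF ψ → T ∣ Γ ⊢ ψ
  ≐refl  : ∀ {Γ} (t : Term) → T ∣ Γ ⊢ t ≐ t
  ≐subst : ∀ {Γ φ s t} → T ∣ Γ ⊢ s ≐ t → T ∣ Γ ⊢ φ [ s /0] → T ∣ Γ ⊢ φ [ t /0]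

vars : (n : ℕ) → Vec Term n
vars n = tabulate (λ i → var (toℕ i))

Z : Term
Z = app zeroF []

S : Term → Term
S t = app succF (t ∷ [])

succSub : Subst
succSub zero    = S (var zero)
succSub (suc i) = var (suc i)

data HA : Formula → Set where
  succ-ne-zero : HA (¬' (S (var 0) ≐ Z))
  succ-inj     : HA (S (var 0) ≐ S (var 1) ⇒ var 0 ≐ var 1)
  proj-eq      : ∀ {n} (i : Fin n) → HA (app (proj i) (vars n) ≐ lookup (vars n) i)
  comp-eq      : ∀ {n m} (f : PR m) (gs : Vec (PR n) m) →
                 HA (app (comp f gs) (vars n) ≐ app f (Vec.map (λ g → app g (vars n)) gs))
  rec-eq₀      : ∀ {n} (g : PR n) (h : PR (suc (suc n))) →
                 HA (app (rec g h) (Z ∷ vars n) ≐ app g (vars n))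
  rec-eqS      : ∀ {n} (g : PR n) (h : PR (suc (suc n))) →
                 HA (app (rec g h) (S (var n) ∷ vars n)
                      ≐ app h (var n ∷ app (rec g h) (var n ∷ vars n) ∷ vars n))
  ind          : (φ : Formula) →
                 HA (φ [ Z /0] ⇒ ∀' (φ ⇒ substF succSub φ) ⇒ ∀' φ)

_⊕_ : (Formula → Set) → (Formula → Set) → Formula → Set
(T ⊕ P) φ = T φ ⊎ P φ

-- Arithmetical hierarchy (prenex; Σ_{k+1} = ∃x⃗ π with x⃗ a nonempty block, π ∈ Π_k)

QF : Formula → Set
QF (s ≐ t)  = ⊤
QF ⊥'       = ⊤
QF (φ ∧' ψ) = QF φ × QF ψ
QF (φ ∨' ψ) = QF φ × QF ψ
QF (φ ⇒ ψ)  = QF φ × QF ψ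
QF (∀' φ)   = ⊥
QF (∃' φ)   = ⊥

mutual
  data Σₖ : ℕ → Formula → Set where
    qfΣ   : ∀ {φ} → QF φ → Σₖ 0 φ
    ∃-new : ∀ {k φ} → Πₖ k φ → Σₖ (suc k) (∃' φ)
    ∃-blk : ∀ {k φ} → Σₖ (suc k) φ → Σₖ (suc k) (∃' φ)

  data Πₖ : ℕ → Formula → Set where
    qfΠ   : ∀ {φ} → QF φ → Πₖ 0 φ
    ∀-new : ∀ {k φ} → Σₖ k φ → Πₖ (suc k) (∀' φ)
    ∀-blk : ∀ {k φ} → Πₖ (suc k) φ → Πₖ (suc k) (∀' φ)

data Sign : Set where
  plus minus : Sign

Path : Set
Path = List Sign

-- i(s): first symbol, nothing standing for ×
i : Path → Maybe Sign
i []      = nothing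
i (a ∷ _) = just a

flipS : Sign → Sign
flipS plus  = minus
flipS minus = plus

_⊥ˢ : Path → Path
s ⊥ˢ = map flipS s

prefixIfNot : Sign → Path → Path
prefixIfNot plus  (plus ∷ s)  = plus ∷ s
prefixIfNot plus  s           = plus ∷ s
prefixIfNot minus (minus ∷ s) = minus ∷ s
prefixIfNot minus s           = minus ∷ s

-- Alt(φ) as a finite list (a set up to duplicates)
Alt : Formula → List Path
Alt (s ≐ t)  = [] ∷ []
Alt ⊥'       = [] ∷ []
Alt (φ ∧' ψ) = Alt φ ++ Alt ψ
Alt (φ ∨' ψ) = Alt φ ++ Alt ψ
Alt (φ ⇒ ψ)  = map _⊥ˢ (Alt φ) ++ Alt ψ
Alt (∀' φ)   = map (prefixIfNot minus) (Alt φ)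
Alt (∃' φ)   = map (prefixIfNot plus) (Alt φ)

deg : Formula → ℕ
deg φ = foldr _⊔_ 0 (map length (Alt φ))

F : ℕ → Formula → Set
F k φ = deg φ ≡ k

U : ℕ → Formula → Set
U zero    φ = F zero φ
U (suc k) φ = F (suc k) φ × All (λ s → length s ≡ suc k → i s ≡ just minus) (Alt φ)

U⁺ : ℕ → Formula → Set
U⁺ k φ = U k φ ⊎ deg φ < k

-- DNS(Γ): ∀x⃗ (∀y ¬¬φ(x⃗,y) → ¬¬∀y φ(x⃗,y)), φ ∈ Γ with free vars among x⃗,y
-- (y = de Bruijn 0, x⃗ = 1..n)
data DNS (Γ : Formula → Set) : Formula → Set where
  dns : (n : ℕ) (φ : Formula) → Γ φ → Wf (suc n) φ →
        DNS Γ (∀^ n (∀' (¬' (¬' φ)) ⇒ ¬' (¬' (∀' φ))))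

data LEM (Γ : Formula → Set) : Formula → Set where
  lem : (n : ℕ) (φ : Formula) → Γ φ → Wf n φ → LEM Γ (∀^ n (φ ∨' ¬' φ))

data ¬¬LEM (Γ : Formula → Set) : Formula → Set where
  nnlem : ∀ {ξ} → LEM Γ ξ → ¬¬LEM Γ (¬' (¬' ξ))

_⊢ˢ_ : (Formula → Set) → (Formula → Set) → Set
T ⊢ˢ P = ∀ ψ → P ψ → T ∣ [] ⊢ ψ

-- If φ ∈ Σ_{k-1}, then φ ∨ ¬φ has alternation degree at most k-1, and each universal
-- quantifier in front of it can only create alternation paths that start with −.  So
-- every ∀y⃗ (φ ∨ ¬φ) lies in U_k^+, and DNS for these formulas pushes the intuitionistically
-- provable ¬¬(φ ∨ ¬φ) through the quantifiers one at a time: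
-- from ∀y ¬¬∀z⃗ (φ ∨ ¬φ) we get ¬¬∀y∀z⃗ (φ ∨ ¬φ).
module Submission where

open import Defs
open import Data.Nat using (ℕ; _<_; _∸_; zero; suc; _+_; _≤_; z≤n; s≤s)
open import Data.Nat.Properties using (⊔-lub; <⇒≢; m≤n⇒m≤1+n; m≤n⇒m<n∨m≡n; +-suc; +-identityʳ)
open import Data.List using ([]; _∷_; map; length)
open import Data.List.Properties using (length-map; map-∘; map-cong; foldr-preservesᵇ)
open import Data.List.Relation.Unary.All using (All; []; _∷_)
import Data.List.Relation.Unary.All as All
open import Data.List.Relation.Unary.All.Properties using (map⁺; ++⁺)
open import Data.List.Relation.Unary.Any using (here; there)
open import Data.Vec using (Vec; []; _∷_)
open import Data.Maybe using (just)
open import Data.Product using (_×_; _,_)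
open import Data.Sum using (_⊎_; inj₁; inj₂)
open import Data.Unit using (tt)
open import Data.Empty using (⊥-elim)
open import Function using (_∘_)
open import Relation.Binary.PropositionalEquality
  using (_≡_; _≗_; refl; cong; cong₂; subst; sym; trans)

lift-cong : {σ τ : Subst} → σ ≗ τ → lift σ ≗ lift τ
lift-cong eq zero    = refl
lift-cong eq (suc i) = cong shiftT (eq i)

mutual
  substT-cong : {σ τ : Subst} → σ ≗ τ → substT σ ≗ substT τ
  substT-cong eq (var i)    = eq i
  substT-cong eq (app f ts) = cong (app f) (substV-cong eq ts)

  substV-cong : ∀ {n} {σ τ : Subst} → σ ≗ τ → (ts : Vec Term n) → substV σ ts ≡ substV τ ts
  substV-cong eq []       = refl
  substV-cong eq (t ∷ ts) = cong₂ _∷_ (substT-cong eq t) (substV-cong eq ts)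

substF-cong : {σ τ : Subst} → σ ≗ τ → substF σ ≗ substF τ
substF-cong eq (s ≐ t)  = cong₂ _≐_ (substT-cong eq s) (substT-cong eq t)
substF-cong eq ⊥'       = refl
substF-cong eq (φ ∧' ψ) = cong₂ _∧'_ (substF-cong eq φ) (substF-cong eq ψ)
substF-cong eq (φ ∨' ψ) = cong₂ _∨'_ (substF-cong eq φ) (substF-cong eq ψ)
substF-cong eq (φ ⇒ ψ)  = cong₂ _⇒_ (substF-cong eq φ) (substF-cong eq ψ)
substF-cong eq (∀' φ)   = cong ∀' (substF-cong (lift-cong eq) φ)
substF-cong eq (∃' φ)   = cong ∃' (substF-cong (lift-cong eq) φ)

lift-id : {σ : Subst} → σ ≗ var → lift σ ≗ var
lift-id eq zero    = refl
lift-id eq (suc i) = cong shiftT (eq i)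

mutual
  substT-id : {σ : Subst} → σ ≗ var → substT σ ≗ (λ t → t)
  substT-id eq (var i)    = eq i
  substT-id eq (app f ts) = cong (app f) (substV-id eq ts)

  substV-id : ∀ {n} {σ : Subst} → σ ≗ var → (ts : Vec Term n) → substV σ ts ≡ ts
  substV-id eq []       = refl
  substV-id eq (t ∷ ts) = cong₂ _∷_ (substT-id eq t) (substV-id eq ts)

substF-id : {σ : Subst} → σ ≗ var → substF σ ≗ (λ φ → φ)
substF-id eq (s ≐ t)  = cong₂ _≐_ (substT-id eq s) (substT-id eq t)
substF-id eq ⊥'       = refl
substF-id eq (φ ∧' ψ) = cong₂ _∧'_ (substF-id eq φ) (substF-id eq ψ)
substF-id eq (φ ∨' ψ) = cong₂ _∨'_ (substF-id eq φ) (substF-id eq ψ)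
substF-id eq (φ ⇒ ψ)  = cong₂ _⇒_ (substF-id eq φ) (substF-id eq ψ)
substF-id eq (∀' φ)   = cong ∀' (substF-id (lift-id eq) φ)
substF-id eq (∃' φ)   = cong ∃' (substF-id (lift-id eq) φ)

liftᴿ : (ℕ → ℕ) → ℕ → ℕ
liftᴿ ρ zero    = zero
liftᴿ ρ (suc i) = suc (ρ i)

lift-renaming : {τ : Subst} {ρ : ℕ → ℕ} → τ ≗ var ∘ ρ → lift τ ≗ var ∘ liftᴿ ρ
lift-renaming eq zero    = refl
lift-renaming eq (suc i) = cong shiftT (eq i)

lift-∘-liftᴿ : (σ : Subst) (ρ : ℕ → ℕ) → lift σ ∘ liftᴿ ρ ≗ lift (σ ∘ ρ)
lift-∘-liftᴿ σ ρ zero    = refl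
lift-∘-liftᴿ σ ρ (suc i) = refl

mutual
  substT-renaming : (σ : Subst) {τ : Subst} {ρ : ℕ → ℕ} → τ ≗ var ∘ ρ →
                    substT σ ∘ substT τ ≗ substT (σ ∘ ρ)
  substT-renaming σ eq (var i)    = cong (substT σ) (eq i)
  substT-renaming σ eq (app f ts) = cong (app f) (substV-renaming σ eq ts)

  substV-renaming : ∀ {n} (σ : Subst) {τ : Subst} {ρ : ℕ → ℕ} → τ ≗ var ∘ ρ →
                    (ts : Vec Term n) → substV σ (substV τ ts) ≡ substV (σ ∘ ρ) ts
  substV-renaming σ eq []       = refl
  substV-renaming σ eq (t ∷ ts) = cong₂ _∷_ (substT-renaming σ eq t) (substV-renaming σ eq ts)

substF-renaming : (σ : Subst) {τ : Subst} {ρ : ℕ → ℕ} → τ ≗ var ∘ ρ →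
                  substF σ ∘ substF τ ≗ substF (σ ∘ ρ)
substF-renaming σ eq (s ≐ t)  = cong₂ _≐_ (substT-renaming σ eq s) (substT-renaming σ eq t)
substF-renaming σ eq ⊥'       = refl
substF-renaming σ eq (φ ∧' ψ) = cong₂ _∧'_ (substF-renaming σ eq φ) (substF-renaming σ eq ψ)
substF-renaming σ eq (φ ∨' ψ) = cong₂ _∨'_ (substF-renaming σ eq φ) (substF-renaming σ eq ψ)
substF-renaming σ eq (φ ⇒ ψ)  = cong₂ _⇒_ (substF-renaming σ eq φ) (substF-renaming σ eq ψ)
substF-renaming σ eq (∀' φ)   =
  cong ∀' (trans (substF-renaming (lift σ) (lift-renaming eq) φ) (substF-cong (lift-∘-liftᴿ σ _) φ))
substF-renaming σ eq (∃' φ)   =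
  cong ∃' (trans (substF-renaming (lift σ) (lift-renaming eq) φ) (substF-cong (lift-∘-liftᴿ σ _) φ))

shift-under-binder-[var0] : (φ : Formula) → substF (lift (var ∘ suc)) φ [ var 0 /0] ≡ φ
shift-under-binder-[var0] φ =
  trans (substF-renaming (sub0 (var 0)) (lift-renaming {ρ = suc} (λ _ → refl)) φ)
        (substF-id sub0-∘-liftᴿ φ)
  where
    sub0-∘-liftᴿ : sub0 (var 0) ∘ liftᴿ suc ≗ var
    sub0-∘-liftᴿ zero    = refl
    sub0-∘-liftᴿ (suc i) = refl

∀^-suc : (m : ℕ) (φ : Formula) → ∀^ (suc m) φ ≡ ∀^ m (∀' φ)
∀^-suc zero    φ = refl
∀^-suc (suc m) φ = cong ∀' (∀^-suc m φ)

Wf-∀^ : (φ : Formula) (n j : ℕ) → Wf (n + j) φ → Wf n (∀^ j φ)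
Wf-∀^ φ n zero    wf = subst (λ m → Wf m φ) (+-identityʳ n) wf
Wf-∀^ φ n (suc j) wf = Wf-∀^ φ (suc n) j (subst (λ m → Wf m φ) (+-suc n j) wf)

module _ {T : Formula → Set} where

  ∀^I : ∀ m {φ} → T ∣ [] ⊢ φ → T ∣ [] ⊢ ∀^ m φ
  ∀^I zero    d = d
  ∀^I (suc m) d = ∀I (∀^I m d)

  ∀E-fresh : ∀ {Γ} (φ : Formula) → T ∣ Γ ⊢ shiftF (∀' φ) → T ∣ Γ ⊢ φ
  ∀E-fresh φ d = subst (T ∣ _ ⊢_) (shift-under-binder-[var0] φ) (∀E d (var 0))

  ∀-distrib-⇒ : (φ ψ : Formula) → T ∣ [] ⊢ ∀' (φ ⇒ ψ) ⇒ ∀' φ ⇒ ∀' ψ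
  ∀-distrib-⇒ φ ψ =
    ⇒I (⇒I (∀I (⇒E (∀E-fresh (φ ⇒ ψ) (hyp (there (here refl))))
                   (∀E-fresh φ (hyp (here refl))))))

  ∀^-⇒E : ∀ m {φ ψ} → T ∣ [] ⊢ ∀^ m (φ ⇒ ψ) → T ∣ [] ⊢ ∀^ m φ → T ∣ [] ⊢ ∀^ m ψ
  ∀^-⇒E zero    d e = ⇒E d e
  ∀^-⇒E (suc m) {φ} {ψ} d e =
    subst (T ∣ [] ⊢_) (sym (∀^-suc m ψ))
      (∀^-⇒E m (∀^-⇒E m (∀^I m (∀-distrib-⇒ φ ψ)) (subst (T ∣ [] ⊢_) (∀^-suc m (φ ⇒ ψ)) d))
               (subst (T ∣ [] ⊢_) (∀^-suc m φ) e))

  ¬¬-lem : (φ : Formula) → T ∣ [] ⊢ ¬' (¬' (φ ∨' ¬' φ))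
  ¬¬-lem φ = ⇒I (⇒E (hyp (here refl)) (∨I₂ (⇒I (⇒E (hyp (there (here refl))) (∨I₁ (hyp (here refl)))))))

module _ {T Γ : Formula → Set} (DNS⊆T : ∀ {φ} → DNS Γ φ → T φ) {ψ : Formula}
         (∀^ψ∈Γ : ∀ j → Γ (∀^ j ψ)) (¬¬ψ : ∀ m → T ∣ [] ⊢ ∀^ m (¬' (¬' ψ))) where

  ¬¬-∀^ : ∀ j m → Wf (m + j) ψ → T ∣ [] ⊢ ∀^ m (¬' (¬' (∀^ j ψ)))
  ¬¬-∀^ zero    m _  = ¬¬ψ m
  ¬¬-∀^ (suc j) m wf =
    ∀^-⇒E m dns-instance (subst (T ∣ [] ⊢_) (∀^-suc m _) (¬¬-∀^ j (suc m) wf′))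
    where
      wf′ : Wf (suc m + j) ψ
      wf′ = subst (λ n → Wf n ψ) (+-suc m j) wf
      χ : Formula
      χ = ∀^ j ψ
      dns-instance : T ∣ [] ⊢ ∀^ m (∀' (¬' (¬' χ)) ⇒ ¬' (¬' (∀' χ)))
      dns-instance = subst (T ∣ [] ⊢_) (substF-id (λ _ → refl) _)
                       (ax (DNS⊆T (dns m χ (∀^ψ∈Γ j) (Wf-∀^ ψ (suc m) j wf′))) var)

Within : ℕ → Path → Set
Within k s = length s ≤ k

⊥ˢ-Within : ∀ {k L} → All (Within k) L → All (Within k) (map _⊥ˢ L)
⊥ˢ-Within {k} = map⁺ ∘ All.map (λ {s} → subst (_≤ k) (sym (length-map flipS s)))

QF-Within : ∀ {φ} → QF φ → All (Within 0) (Alt φ)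
QF-Within {_ ≐ _}  _       = z≤n ∷ []
QF-Within {⊥'}     _       = z≤n ∷ []
QF-Within {_ ∧' _} (p , q) = ++⁺ (QF-Within p) (QF-Within q)
QF-Within {_ ∨' _} (p , q) = ++⁺ (QF-Within p) (QF-Within q)
QF-Within {_ ⇒ _}  (p , q) = ++⁺ (⊥ˢ-Within (QF-Within p)) (QF-Within q)

prefixIfNot-Within : ∀ a {k} s → Within k s → Within (suc k) (prefixIfNot a s)
prefixIfNot-Within plus  []          _ = s≤s z≤n
prefixIfNot-Within plus  (plus ∷ _)  l = m≤n⇒m≤1+n l
prefixIfNot-Within plus  (minus ∷ _) l = s≤s l
prefixIfNot-Within minus []          _ = s≤s z≤n
prefixIfNot-Within minus (plus ∷ _)  l = s≤s l
prefixIfNot-Within minus (minus ∷ _) l = m≤n⇒m≤1+n l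

prefixIfNot-idem : ∀ a s → prefixIfNot a (prefixIfNot a s) ≡ prefixIfNot a s
prefixIfNot-idem plus  []          = refl
prefixIfNot-idem plus  (plus ∷ _)  = refl
prefixIfNot-idem plus  (minus ∷ _) = refl
prefixIfNot-idem minus []          = refl
prefixIfNot-idem minus (plus ∷ _)  = refl
prefixIfNot-idem minus (minus ∷ _) = refl

map-prefixIfNot-idem : ∀ a L → map (prefixIfNot a) (map (prefixIfNot a) L) ≡ map (prefixIfNot a) L
map-prefixIfNot-idem a L = trans (sym (map-∘ L)) (map-cong (prefixIfNot-idem a) L)

Alt-∃-absorbed : ∀ {k φ} → Σₖ (suc k) φ → Alt (∃' φ) ≡ Alt φ
Alt-∃-absorbed (∃-new {φ = φ} _) = map-prefixIfNot-idem plus (Alt φ)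
Alt-∃-absorbed (∃-blk {φ = φ} _) = map-prefixIfNot-idem plus (Alt φ)

Alt-∀-absorbed : ∀ {k φ} → Πₖ (suc k) φ → Alt (∀' φ) ≡ Alt φ
Alt-∀-absorbed (∀-new {φ = φ} _) = map-prefixIfNot-idem minus (Alt φ)
Alt-∀-absorbed (∀-blk {φ = φ} _) = map-prefixIfNot-idem minus (Alt φ)

mutual
  Σₖ-Within : ∀ {k φ} → Σₖ k φ → All (Within k) (Alt φ)
  Σₖ-Within (qfΣ q)   = QF-Within q
  Σₖ-Within (∃-new p) = map⁺ (All.map (λ {s} → prefixIfNot-Within plus s) (Πₖ-Within p))
  Σₖ-Within (∃-blk p) = subst (All _) (sym (Alt-∃-absorbed p)) (Σₖ-Within p)

  Πₖ-Within : ∀ {k φ} → Πₖ k φ → All (Within k) (Alt φ)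
  Πₖ-Within (qfΠ q)   = QF-Within q
  Πₖ-Within (∀-new p) = map⁺ (All.map (λ {s} → prefixIfNot-Within minus s) (Σₖ-Within p))
  Πₖ-Within (∀-blk p) = subst (All _) (sym (Alt-∀-absorbed p)) (Πₖ-Within p)

LEM-Within : ∀ {k φ} → Σₖ k φ → All (Within k) (Alt (φ ∨' ¬' φ))
LEM-Within p = ++⁺ (Σₖ-Within p) (++⁺ (⊥ˢ-Within (Σₖ-Within p)) (z≤n ∷ []))

deg-≤ : ∀ {n} φ → All (Within n) (Alt φ) → deg φ ≤ n
deg-≤ {n} φ w = foldr-preservesᵇ {P = _≤ n} ⊔-lub z≤n (map⁺ w)

UPath : ℕ → Path → Set
UPath k s = Within k s ⊎ (i s ≡ just minus × Within (suc k) s)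

prefixIfNot-minus-UPath : ∀ {k} s → UPath k s → UPath k (prefixIfNot minus s)
prefixIfNot-minus-UPath []          _              = inj₂ (refl , s≤s z≤n)
prefixIfNot-minus-UPath (minus ∷ _) u              = u
prefixIfNot-minus-UPath (plus ∷ _)  (inj₁ l)       = inj₂ (refl , s≤s l)
prefixIfNot-minus-UPath (plus ∷ _)  (inj₂ (() , _))

∀^-UPath : ∀ j {k φ} → All (UPath k) (Alt φ) → All (UPath k) (Alt (∀^ j φ))
∀^-UPath zero    u = u
∀^-UPath (suc j) u = map⁺ (All.map (λ {s} → prefixIfNot-minus-UPath s) (∀^-UPath j u))

UPath⇒U⁺ : ∀ {k} φ → All (UPath k) (Alt φ) → U⁺ (suc k) φ
UPath⇒U⁺ {k} φ u with m≤n⇒m<n∨m≡n (deg-≤ φ (All.map Within-suc u))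
  where
    Within-suc : ∀ {s} → UPath k s → Within (suc k) s
    Within-suc (inj₁ l)       = m≤n⇒m≤1+n l
    Within-suc (inj₂ (_ , l)) = l
... | inj₁ deg< = inj₂ deg<
... | inj₂ deg≡ = inj₁ (deg≡ , All.map longest-starts-with-minus u)
  where
    longest-starts-with-minus : ∀ {s} → UPath k s → length s ≡ suc k → i s ≡ just minus
    longest-starts-with-minus (inj₁ l)       eq = ⊥-elim (<⇒≢ (s≤s l) eq)
    longest-starts-with-minus (inj₂ (h , _)) _  = h

lemma4p9 : (k : ℕ) → 0 < k → (HA ⊕ DNS (U⁺ k)) ⊢ˢ ¬¬LEM (Σₖ (k ∸ 1))
lemma4p9 (suc k) _ _ (nnlem (lem n φ p wf)) =
  ¬¬-∀^ inj₂ ∀^lem∈U⁺ (λ m → ∀^I m (¬¬-lem φ)) n 0 (wf , wf , tt)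
  where
    ∀^lem∈U⁺ : ∀ j → U⁺ (suc k) (∀^ j (φ ∨' ¬' φ))
    ∀^lem∈U⁺ j = UPath⇒U⁺ (∀^ j (φ ∨' ¬' φ)) (∀^-UPath j (All.map inj₁ (LEM-Within p)))
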